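{- Let $\mathcal{X}$ be a connected $n$-premaniplex and let $(\mathcal{Y},\eta)$ be an $(n,m)$-voltage operator that preserves connectivity. Let $\gamma\in\mathrm{Aut}(\mathcal{X}\rtimes_\eta\mathcal{Y})$. If there exist a flag $(x_0,y_0)\in\mathcal{X}\rtimes_\eta\mathcal{Y}$ and $x_1\in\mathcal{X}$ such that $(x_0,y_0)\gamma=(x_1,y_0)$, then $\gamma$ may be regarded as an automorphism of $\mathcal{X}$: there is $\sigma\in\mathrm{Aut}(\mathcal{X})$ with $(x,y)\gamma=(x\sigma,y)$ for all flags $(x,y)$.
   Context: A graph may have multiple edges and semi-edges (darts equal to their own inverse). An $n$-premaniplex is such a graph with edges coloured by $\{0,\dots,n-1\}$ so that every vertex (called a flag) is the starting point of exactly one dart of each colour, and whenever $|i-j|\ge2$ every alternating path of length 4 with colours $i,j$ is closed. For a flag $x$, $x^i$ is the end of the $i$-coloured dart starting at $x$. Let $\mathcal{C}^n=\langle r_0,\dots,r_{n-1}\mid r_i^2=1,\ (r_ir_j)^2=1\ (|i-j|\ge2)\rangle$; it acts on the left on flags by $r_ix=x^i$. Homomorphisms of premaniplexes are maps of flags preserving every $i$-adjacency; automorphisms are bijective homomorphisms of a premaniplex to itself, act on the right ($x\mapsto x\gamma$) and commute with the action of $\mathcal{C}^n$. For a flag $y$ of an $m$-premaniplex $\mathcal{Y}$ and $\omega\in\mathcal{C}^m$, $P_\omega(y)$ is the homotopy class of paths starting at $y$ whose successive dart colours $i_1,\dots,i_k$ satisfy $r_{i_k}\cdots r_{i_1}=\omega$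 (two paths are homotopic iff they start at the same flag and their colour words give the same element of $\mathcal{C}^m$); such paths end at $\omega y$. These classes form the fundamental groupoid $\Pi(\mathcal{Y})$ under concatenation. A voltage assignment is a map $\eta:\Pi(\mathcal{Y})\to\mathcal{C}^n$ with $\eta(W_1W_2)=\eta(W_2)\eta(W_1)$ whenever $W_1W_2$ is defined; $(\mathcal{Y},\eta)$ is then an $(n,m)$-voltage operator. For an $n$-premaniplex $\mathcal{X}$, the $m$-premaniplex $\mathcal{X}\rtimes_\eta\mathcal{Y}$ has flags $\mathcal{X}\times\mathcal{Y}$ and $(x,y)^i=(\eta(P_{r_i}(y))x,\,y^i)$ for $0\le i\le m-1$; hence $\omega(x,y)=(\eta(P_\omega(y))x,\omega y)$. The operator preserves connectivity if $\mathcal{X}\rtimes_\eta\mathcal{Y}$ is connected whenever $\mathcal{X}$ is connected. Standing assumption: $\mathcal{Y}$ has a spanning tree (spanning forest if disconnected) all of whose darts have trivial voltage. -}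

module Defs where

open import Data.Nat using (ℕ; _≤_; ∣_-_∣)
open import Data.Fin using (Fin; toℕ)
open import Data.List using (List; []; _∷_; _++_)
open import Data.Product using (Σ; _×_; _,_; ∃; proj₁; proj₂)
open import Data.Unit using (⊤)
open import Relation.Binary.PropositionalEquality using (_≡_; _≢_)
open import Relation.Nullary using (¬_)

Far : {n : ℕ} → Fin n → Fin n → Set
Far i j = 2 ≤ ∣ toℕ i - toℕ j ∣

-- The universal Coxeter group C^n, presented by words modulo relations.
-- A word  i₁ ∷ i₂ ∷ … ∷ iₖ ∷ []  denotes the element r_{i₁} r_{i₂} ⋯ r_{iₖ}.

Word : ℕ → Set
Word n = List (Fin n)

data _≈C_ {n : ℕ} : Word n → Word n → Set where
  ≈refl  : ∀ {w} → w ≈C w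
  ≈sym   : ∀ {w w'} → w ≈C w' → w' ≈C w
  ≈trans : ∀ {w w' w''} → w ≈C w' → w' ≈C w'' → w ≈C w''
  ≈cong  : ∀ {u u' v v'} → u ≈C u' → v ≈C v' → (u ++ v) ≈C (u' ++ v')
  ≈inv   : ∀ i → (i ∷ i ∷ []) ≈C []
  ≈comm  : ∀ i j → Far i j → (i ∷ j ∷ i ∷ j ∷ []) ≈C []

-- Coloured "graphs" where every flag has exactly one dart of each colour:
-- given by the functions x ↦ x^i.

record PreGraph (n : ℕ) : Set₁ where
  field
    Flag : Set
    adj  : Fin n → Flag → Flag

  act : Word n → Flag → Flag
  act []      x = x
  act (i ∷ w) x = adj i (act w x)

  Connected : Set
  Connected = ∀ (x x' : Flag) → Σ (Word n) λ w → act w x ≡ x'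

open PreGraph public

-- automorphisms (acting on the right: x γ = fwd x)
record Aut {n : ℕ} (G : PreGraph n) : Set where
  field
    fwd   : Flag G → Flag G
    bwd   : Flag G → Flag G
    bwd∘fwd : ∀ x → bwd (fwd x) ≡ x
    fwd∘bwd : ∀ x → fwd (bwd x) ≡ x
    hom   : ∀ i x → fwd (adj G i x) ≡ adj G i (fwd x)

open Aut public

-- n-premaniplex: darts x→x^i are involutive (semi-edges allowed: x^i ≡ x),
-- and alternating i,j paths of length 4 are closed when |i-j| ≥ 2
record Premaniplex (n : ℕ) : Set₁ where
  field
    graph : PreGraph n
    invol : ∀ i x → adj graph i (adj graph i x) ≡ x
    comm  : ∀ i j → Far i j → ∀ x →
            adj graph j (adj graph i (adj graph j (adj graph i x))) ≡ x

open Premaniplex public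

-- The homotopy class P_ω(y) is the pair (y , ω), so a
-- voltage assignment is a function of y and of the element ω ∈ C^m
-- (respecting ≈C), satisfying η(W₁W₂) = η(W₂)η(W₁), i.e.
-- η(P_{ω₂ω₁}(y)) = η(P_{ω₂}(ω₁ y)) η(P_{ω₁}(y)).

record VoltageOperator (n m : ℕ) : Set₁ where
  field
    Y     : Premaniplex m
    η     : Flag (graph Y) → Word m → Word n
    η-resp : ∀ y {w w'} → w ≈C w' → η y w ≈C η y w'
    η-comp : ∀ y (ω₂ ω₁ : Word m) →
             η y (ω₂ ++ ω₁) ≈C (η (act (graph Y) ω₁ y) ω₂ ++ η y ω₁)

open VoltageOperator public

_⋊_ : {n m : ℕ} → Premaniplex n → VoltageOperator n m → PreGraph m
Flag (X ⋊ V) = Flag (graph X) × Flag (graph (Y V))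
adj  (X ⋊ V) i (x , y) =
  act (graph X) (η V y (i ∷ [])) x , adj (graph (Y V)) i y

PreservesConnectivity : {n m : ℕ} → VoltageOperator n m → Set₁
PreservesConnectivity {n} V =
  ∀ (X : Premaniplex n) → Connected (graph X) → Connected (X ⋊ V)

-- Spanning forests of Y (sets T of darts; a dart is (y , i), from y to y^i)

module _ {m : ℕ} (G : PreGraph m) where

  endpoint : Flag G → List (Fin m) → Flag G
  endpoint y []      = y
  endpoint y (i ∷ w) = endpoint (adj G i y) w

  AllIn : (Flag G → Fin m → Set) → Flag G → List (Fin m) → Set
  AllIn T y []      = ⊤
  AllIn T y (i ∷ w) = T y i × AllIn T (adj G i y) w

-- non-backtracking: consecutive darts are never mutually inverse
-- (the dart after (y,i) with the same colour i is its inverse)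
Reduced : {m : ℕ} → List (Fin m) → Set
Reduced []            = ⊤
Reduced (i ∷ [])      = ⊤
Reduced (i ∷ j ∷ w)   = (i ≢ j) × Reduced (j ∷ w)

record SpanningForest {m : ℕ} (G : PreGraph m) (T : Flag G → Fin m → Set) : Set where
  field
    sym-closed : ∀ y i → T y i → T (adj G i y) i
    -- spanning: T joins any two flags that are joined in G
    spanning   : ∀ y (w : List (Fin m)) →
                 Σ (List (Fin m)) λ w' → AllIn G T y w' × (endpoint G y w' ≡ endpoint G y w)
    acyclic    : ∀ y i (w : List (Fin m)) → Reduced (i ∷ w) → AllIn G T y (i ∷ w) →
                 ¬ (endpoint G y (i ∷ w) ≡ y)

HasTrivialSpanningForest : {n m : ℕ} → VoltageOperator n m → Set₁
HasTrivialSpanningForest {n} {m} V =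
  Σ (Flag (graph (Y V)) → Fin m → Set) λ T →
    SpanningForest (graph (Y V)) T ×
    (∀ y i → T y i → η V y (i ∷ []) ≈C [])

-- Write f x for the first coordinate of (x , y₀)γ.  Since X ⋊ Y is connected and γ commutes with
-- the action of C^m, the Y-coordinate of (x , y₀)γ determines that of every image, so γ preserves
-- Y-coordinates; moving along darts of the spanning forest, whose voltages are trivial, shows
-- (x , y)γ = (f x , y) for every y.  Consequently f commutes with the action of every voltage
-- η(P_w(y)).  Finally, applying the operator to the universal n-premaniplex (the flag graph of
-- C^n itself, realised by heaps of dominoes) shows that every generator r_j is the voltage
-- of some path from y₀, so f commutes with each r_j and is an automorphism of X.
{-# OPTIONS --safe #-}
module Submission where

open import Defs
open import Data.Nat using (ℕ; zero; suc; _+_; _≤_; s≤s; z≤n)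
open import Data.Nat.Properties using (+-suc; ∣-∣-comm)
open import Data.Fin using (Fin; zero; suc; toℕ)
open import Data.Fin.Properties using (any?; all?) renaming (_≟_ to _≟ᶠ_)
open import Data.Bool using (Bool; true; false; if_then_else_)
open import Data.Bool.Properties using (T-irrelevant) renaming (_≟_ to _≟ᴮ_)
open import Data.List using (List; []; _∷_; _++_; reverse; [_])
open import Data.List.Properties using (unfold-reverse) renaming (≡-dec to ≡-decᴸ)
open import Data.Vec using (Vec; []; _∷_; replicate)
open import Data.Vec.Properties using () renaming (≡-dec to ≡-decⱽ)
open import Data.Product using (Σ; ∃; _×_; _,_; proj₁; proj₂)
open import Data.Empty using (⊥; ⊥-elim)
open import Function using (_∘_)
open import Relation.Binary.PropositionalEquality hiding ([_])
open import Relation.Nullary using (Dec)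
open import Relation.Nullary.Decidable
  using (yes; no; True; toWitness; fromWitness; _×-dec_; _→-dec_)

Far-sym : ∀ {n} (i j : Fin n) → Far i j → Far j i
Far-sym i j = subst (2 ≤_) (∣-∣-comm (toℕ i) (toℕ j))

act-++ : ∀ {n} (G : PreGraph n) u v x → act G (u ++ v) x ≡ act G u (act G v x)
act-++ G []      v x = refl
act-++ G (i ∷ u) v x = cong (adj G i) (act-++ G u v x)

fwd-act : ∀ {n} {G : PreGraph n} (γ : Aut G) w x → fwd γ (act G w x) ≡ act G w (fwd γ x)
fwd-act         γ []      x = refl
fwd-act {G = G} γ (i ∷ w) x = trans (hom γ i (act G w x)) (cong (adj G i) (fwd-act γ w x))

endpoint-++ : ∀ {m} (G : PreGraph m) y u v →
              endpoint G y (u ++ v) ≡ endpoint G (endpoint G y u) v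
endpoint-++ G y []      v = refl
endpoint-++ G y (i ∷ u) v = endpoint-++ G (adj G i y) u v

endpoint-reverse : ∀ {m} (G : PreGraph m) w y → endpoint G y (reverse w) ≡ act G w y
endpoint-reverse G []      y = refl
endpoint-reverse G (i ∷ w) y = begin
  endpoint G y (reverse (i ∷ w))           ≡⟨ cong (endpoint G y) (unfold-reverse i w) ⟩
  endpoint G y (reverse w ++ [ i ])        ≡⟨ endpoint-++ G y (reverse w) [ i ] ⟩
  adj G i (endpoint G y (reverse w))       ≡⟨ cong (adj G i) (endpoint-reverse G w y) ⟩
  adj G i (act G w y)                      ∎
  where open ≡-Reasoning

module _ {n : ℕ} (P : Premaniplex n) where
  private
    G = graph P

  act-resp-≈C : ∀ {w w'} → w ≈C w' → ∀ x → act G w x ≡ act G w' x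
  act-resp-≈C ≈refl                            x = refl
  act-resp-≈C (≈sym e)                         x = sym (act-resp-≈C e x)
  act-resp-≈C (≈trans e e')                    x = trans (act-resp-≈C e x) (act-resp-≈C e' x)
  act-resp-≈C (≈cong {u} {u'} {v} {v'} e e')   x = begin
    act G (u ++ v) x       ≡⟨ act-++ G u v x ⟩
    act G u (act G v x)    ≡⟨ act-resp-≈C e (act G v x) ⟩
    act G u' (act G v x)   ≡⟨ cong (act G u') (act-resp-≈C e' x) ⟩
    act G u' (act G v' x)  ≡⟨ act-++ G u' v' x ⟨
    act G (u' ++ v') x     ∎
    where open ≡-Reasoning
  act-resp-≈C (≈inv i)                         x = invol P i x
  act-resp-≈C (≈comm i j far)                  x = comm P j i (Far-sym i j far) x

  act-reverse-cancel : ∀ w x → act G (reverse w) (act G w x) ≡ x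
  act-reverse-cancel []      x = refl
  act-reverse-cancel (i ∷ w) x = begin
    act G (reverse (i ∷ w)) y                ≡⟨ cong (λ u → act G u y) (unfold-reverse i w) ⟩
    act G (reverse w ++ [ i ]) y             ≡⟨ act-++ G (reverse w) [ i ] y ⟩
    act G (reverse w) (adj G i y)            ≡⟨ cong (act G (reverse w)) (invol P i _) ⟩
    act G (reverse w) (act G w x)            ≡⟨ act-reverse-cancel w x ⟩
    x                                        ∎
    where
    open ≡-Reasoning
    y = adj G i (act G w x)

  adj-comm : ∀ {i j} → Far i j → ∀ x → adj G i (adj G j x) ≡ adj G j (adj G i x)
  adj-comm {i} {j} far x = begin
    u                                        ≡⟨ invol P j u ⟨
    adj G j (adj G j u)                      ≡⟨ cong (adj G j) (invol P i (adj G j u)) ⟨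
    adj G j (adj G i (adj G i (adj G j u)))  ≡⟨ cong (adj G j ∘ adj G i) closed ⟩
    adj G j (adj G i x)                      ∎
    where
    open ≡-Reasoning
    u = adj G i (adj G j x)
    closed : adj G i (adj G j u) ≡ x
    closed = comm P j i (Far-sym i j far) x

  connected-from : ∀ b → (∀ z → ∃ λ w → act G w b ≡ z) → Connected G
  connected-from b reach z z' with reach z | reach z'
  ... | w , refl | w' , refl = w' ++ reverse w , (begin
    act G (w' ++ reverse w) (act G w b)        ≡⟨ act-++ G w' (reverse w) _ ⟩
    act G w' (act G (reverse w) (act G w b))   ≡⟨ cong (act G w') (act-reverse-cancel w b) ⟩
    act G w' b                                 ∎)
    where open ≡-Reasoning

module _ {n m : ℕ} (X : Premaniplex n) (V : VoltageOperator n m) where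
  private
    XG = graph X
    YG = graph (Y V)

  η-[]-acts-trivially : ∀ y x → act XG (η V y []) x ≡ x
  η-[]-acts-trivially y x = begin
    act XG u x                                   ≡⟨ act-reverse-cancel X u (act XG u x) ⟨
    act XG (reverse u) (act XG u (act XG u x))   ≡⟨ cong (act XG (reverse u)) idempotent ⟩
    act XG (reverse u) (act XG u x)              ≡⟨ act-reverse-cancel X u x ⟩
    x                                            ∎
    where
    open ≡-Reasoning
    u = η V y []
    idempotent : act XG u (act XG u x) ≡ act XG u x
    idempotent = sym (trans (act-resp-≈C X (η-comp V y [] []) x) (act-++ XG u u x))

  act-⋊ : ∀ w x y → act (X ⋊ V) w (x , y) ≡ (act XG (η V y w) x , act YG w y)
  act-⋊ []      x y = cong (_, y) (sym (η-[]-acts-trivially y x))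
  act-⋊ (i ∷ w) x y = begin
    adj (X ⋊ V) i (act (X ⋊ V) w (x , y))
      ≡⟨ cong (adj (X ⋊ V) i) (act-⋊ w x y) ⟩
    (act XG (η V (act YG w y) [ i ]) (act XG (η V y w) x) , adj YG i (act YG w y))
      ≡⟨ cong (_, _) (act-++ XG (η V (act YG w y) [ i ]) (η V y w) x) ⟨
    (act XG (η V (act YG w y) [ i ] ++ η V y w) x , adj YG i (act YG w y))
      ≡⟨ cong (_, _) (act-resp-≈C X (η-comp V y [ i ] w) x) ⟨
    (act XG (η V y (i ∷ w)) x , adj YG i (act YG w y))
      ∎
    where open ≡-Reasoning

  act-⋊-Y : ∀ w p → proj₂ (act (X ⋊ V) w p) ≡ act YG w (proj₂ p)
  act-⋊-Y w (x , y) = cong proj₂ (act-⋊ w x y)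

  ⋊-connected⇒Y-connected : Connected (X ⋊ V) → Flag XG → Connected YG
  ⋊-connected⇒Y-connected conn x y y' with conn (x , y) (x , y')
  ... | w , reaches = w , trans (sym (act-⋊-Y w (x , y))) (cong proj₂ reaches)

forest-path : ∀ {m} {G : PreGraph m} {T} → SpanningForest G T → Connected G →
              ∀ y y' → Σ (List (Fin m)) λ w → AllIn G T y w × endpoint G y w ≡ y'
forest-path {G = G} forest conn y y' with conn y y'
... | w , refl with SpanningForest.spanning forest y (reverse w)
...   | w' , in-T , ends = w' , in-T , trans ends (endpoint-reverse G w y)

-- Heaps of dominoes: piece k of C^n occupies columns k and k+1 of a heap of n+1 columns,
-- recorded as true on column k and false on column k+1.  Pieces k and k' overlap exactly when
-- r_k and r_k' do not commute, so r_k acts by removing piece k when it lies on top and by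
-- placing it otherwise; heaps are thereby normal forms for the elements of C^n.

Stacks : ℕ → Set
Stacks n = Vec (List Bool) (suc n)

ColumnPair : Set
ColumnPair = List Bool × List Bool

columns : ∀ {n} → Fin n → Stacks n → ColumnPair
columns zero    (a ∷ b ∷ _) = a , b
columns (suc k) (_ ∷ t)     = columns k t

update : ∀ {n} → Fin n → (ColumnPair → ColumnPair) → Stacks n → Stacks n
update zero    g (a ∷ b ∷ t) = proj₁ (g (a , b)) ∷ proj₂ (g (a , b)) ∷ t
update (suc k) g (a ∷ t)     = a ∷ update k g t

columns-update : ∀ {n} (k : Fin n) g t → columns k (update k g t) ≡ g (columns k t)
columns-update zero    g (a ∷ b ∷ t) = refl
columns-update (suc k) g (a ∷ t)     = columns-update k g t

update-∘ : ∀ {n} (k : Fin n) g h t → update k g (update k h t) ≡ update k (g ∘ h) t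
update-∘ zero    g h (a ∷ b ∷ t) = refl
update-∘ (suc k) g h (a ∷ t)     = cong (a ∷_) (update-∘ k g h t)

update-cong : ∀ {n} (k : Fin n) g h t → g (columns k t) ≡ h (columns k t) →
              update k g t ≡ update k h t
update-cong zero    g h (a ∷ b ∷ t) e = cong (λ p → proj₁ p ∷ proj₂ p ∷ t) e
update-cong (suc k) g h (a ∷ t)     e = cong (a ∷_) (update-cong k g h t e)

update-fixed : ∀ {n} (k : Fin n) g t → g (columns k t) ≡ columns k t → update k g t ≡ t
update-fixed zero    g (a ∷ b ∷ t) e = cong (λ p → proj₁ p ∷ proj₂ p ∷ t) e
update-fixed (suc k) g (a ∷ t)     e = cong (a ∷_) (update-fixed k g t e)

columns-far : ∀ {n} (k k' : Fin n) g t → Far k k' → columns k' (update k g t) ≡ columns k' t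
columns-far zero          zero           g t           ()
columns-far zero          (suc zero)     g t           (s≤s ())
columns-far zero          (suc (suc k')) g (a ∷ b ∷ t) far = refl
columns-far (suc zero)    zero           g t           (s≤s ())
columns-far (suc (suc k)) zero           g (a ∷ b ∷ t) far = refl
columns-far (suc k)       (suc k')       g (a ∷ t)     far = columns-far k k' g t far

update-far : ∀ {n} (k k' : Fin n) g h t → Far k k' →
             update k g (update k' h t) ≡ update k' h (update k g t)
update-far zero          zero           g h t           ()
update-far zero          (suc zero)     g h t           (s≤s ())
update-far zero          (suc (suc k')) g h (a ∷ b ∷ t) far = refl
update-far (suc zero)    zero           g h t           (s≤s ())
update-far (suc (suc k)) zero           g h (a ∷ b ∷ t) far = refl
update-far (suc k)       (suc k')       g h (a ∷ t)     far = cong (a ∷_) (update-far k k' g h t far)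

capped : ColumnPair → Bool
capped (true ∷ _ , false ∷ _) = true
capped _                      = false

push pop switch : ColumnPair → ColumnPair
push (a , b)         = true ∷ a , false ∷ b
pop (_ ∷ a , _ ∷ b)  = a , b
pop p                = p
switch p             = if capped p then pop p else push p

push-pop : ∀ p → capped p ≡ true → push (pop p) ≡ p
push-pop (true ∷ a , false ∷ b) _ = refl
push-pop ([] , _)               ()
push-pop (false ∷ _ , _)        ()
push-pop (true ∷ _ , [])        ()
push-pop (true ∷ _ , true ∷ _)  ()

capped-chain : ∀ {a b c} → capped (a , b) ≡ true → capped (b , c) ≡ true → ⊥
capped-chain {[]}                        ()
capped-chain {false ∷ _}                 ()
capped-chain {true ∷ _} {[]}             ()
capped-chain {true ∷ _} {true ∷ _}       ()
capped-chain {true ∷ _} {false ∷ _} _    ()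

onTop : ∀ {n} → Fin n → Stacks n → Bool
onTop k t = capped (columns k t)

remove place toggle : ∀ {n} → Fin n → Stacks n → Stacks n
remove k = update k pop
place  k = update k push
toggle k = update k switch

empty : ∀ {n} → Stacks n
empty = replicate _ []

onTop-empty : ∀ {n} (k : Fin n) → onTop k empty ≡ false
onTop-empty zero    = refl
onTop-empty (suc k) = onTop-empty k

onTop-place : ∀ {n} (k : Fin n) t → onTop k (place k t) ≡ true
onTop-place k t = cong capped (columns-update k push t)

remove-place : ∀ {n} (k : Fin n) t → remove k (place k t) ≡ t
remove-place k t = trans (update-∘ k pop push t) (update-fixed k (pop ∘ push) t refl)

place-remove : ∀ {n} (k : Fin n) t → onTop k t ≡ true → place k (remove k t) ≡ t
place-remove k t top = trans (update-∘ k push pop t) (update-fixed k (push ∘ pop) t (push-pop _ top))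

toggle-onTop : ∀ {n} (k : Fin n) t → onTop k t ≡ true → toggle k t ≡ remove k t
toggle-onTop k t top = update-cong k switch pop t switch-pop
  where
  switch-pop : switch (columns k t) ≡ pop (columns k t)
  switch-pop rewrite top = refl

toggle-offTop : ∀ {n} (k : Fin n) t → onTop k t ≡ false → toggle k t ≡ place k t
toggle-offTop k t off = update-cong k switch push t switch-push
  where
  switch-push : switch (columns k t) ≡ push (columns k t)
  switch-push rewrite off = refl

onTop-far : ∀ {n} (k k' : Fin n) g t → Far k k' → onTop k' (update k g t) ≡ onTop k' t
onTop-far k k' g t far = cong capped (columns-far k k' g t far)

onTop-apart : ∀ {n} (k k' : Fin n) t → onTop k t ≡ true → onTop k' t ≡ true → k ≢ k' → Far k k'
onTop-apart zero          zero           _               _   _    k≢k' = ⊥-elim (k≢k' refl)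
onTop-apart zero          (suc zero)     (a ∷ b ∷ c ∷ _) top top' _    = ⊥-elim (capped-chain top top')
onTop-apart zero          (suc (suc _))  _               _   _    _    = s≤s (s≤s z≤n)
onTop-apart (suc zero)    zero           (a ∷ b ∷ c ∷ _) top top' _    = ⊥-elim (capped-chain top' top)
onTop-apart (suc (suc _)) zero           _               _   _    _    = s≤s (s≤s z≤n)
onTop-apart (suc k)       (suc k')       (_ ∷ t)         top top' k≢k' =
  onTop-apart k k' t top top' (k≢k' ∘ cong suc)

trues : List Bool → ℕ
trues []          = 0
trues (true ∷ c)  = suc (trues c)
trues (false ∷ c) = trues c

pieces : ∀ {m} → Vec (List Bool) m → ℕ
pieces []      = 0
pieces (c ∷ t) = trues c + pieces t

pieces-empty : ∀ m → pieces (replicate m []) ≡ 0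
pieces-empty zero    = refl
pieces-empty (suc m) = pieces-empty m

pieces-remove : ∀ {n} (k : Fin n) t → onTop k t ≡ true → pieces t ≡ suc (pieces (remove k t))
pieces-remove zero    ((true ∷ a) ∷ (false ∷ b) ∷ t) _   = refl
pieces-remove zero    ([] ∷ _ ∷ _)                   ()
pieces-remove zero    ((false ∷ _) ∷ _ ∷ _)          ()
pieces-remove zero    ((true ∷ _) ∷ [] ∷ _)          ()
pieces-remove zero    ((true ∷ _) ∷ (true ∷ _) ∷ _)  ()
pieces-remove (suc k) (c ∷ t)                        top =
  trans (cong (trues c +_) (pieces-remove k t top)) (+-suc (trues c) _)

-- t is a heap of f pieces.  Requiring that removing a top piece k never exposes another piece k
-- rules out the cancelling word r_k r_k.
IsHeap : ∀ {n} → ℕ → Stacks n → Set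
IsHeap zero    t = t ≡ empty
IsHeap (suc f) t = (∃ λ k → onTop k t ≡ true) ×
                   (∀ k → onTop k t ≡ true → onTop k (remove k t) ≡ false × IsHeap f (remove k t))

isHeap? : ∀ {n} f (t : Stacks n) → Dec (IsHeap f t)
isHeap? zero    t = ≡-decⱽ (≡-decᴸ _≟ᴮ_) t empty
isHeap? (suc f) t =
  any? (λ k → onTop k t ≟ᴮ true) ×-dec
  all? λ k → (onTop k t ≟ᴮ true) →-dec
             ((onTop k (remove k t) ≟ᴮ false) ×-dec isHeap? f (remove k t))

Heap : ∀ {n} → Stacks n → Set
Heap t = IsHeap (pieces t) t

IsHeap-zero-noTop : ∀ {n} (k : Fin n) {t} → IsHeap zero t → onTop k t ≡ true → ⊥
IsHeap-zero-noTop k refl top with () ← trans (sym top) (onTop-empty k)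

heap-remove : ∀ {n} (k : Fin n) {t} → Heap t → onTop k t ≡ true →
              onTop k (remove k t) ≡ false × Heap (remove k t)
heap-remove k {t} h top =
  proj₂ (subst (λ f → IsHeap f t) (pieces-remove k t top) h) k top

mutual
  place-IsHeap : ∀ {n} f {k : Fin n} {t} → IsHeap f t → onTop k t ≡ false →
                 IsHeap (suc f) (place k t)
  place-IsHeap f {k} {t} h off = (k , onTop-place k t) , removable
    where
    removable : ∀ k' → onTop k' (place k t) ≡ true →
                onTop k' (remove k' (place k t)) ≡ false × IsHeap f (remove k' (place k t))
    removable k' top with k' ≟ᶠ k
    ... | yes refl = subst (λ s → onTop k s ≡ false × IsHeap f s) (sym (remove-place k t)) (off , h)
    ... | no k'≢k  = remove-other-placed f h off apart (trans (sym (onTop-far k k' push t apart)) top)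
      where
      apart : Far k k'
      apart = onTop-apart k k' (place k t) (onTop-place k t) top (k'≢k ∘ sym)

  remove-other-placed : ∀ {n} f {k k' : Fin n} {t} → IsHeap f t → onTop k t ≡ false → Far k k' →
                        onTop k' t ≡ true →
                        onTop k' (remove k' (place k t)) ≡ false × IsHeap f (remove k' (place k t))
  remove-other-placed zero    {k' = k'} h _ _ top' = ⊥-elim (IsHeap-zero-noTop k' h top')
  remove-other-placed (suc f) {k} {k'} {t} (_ , below) off apart top' =
    subst (λ s → onTop k' s ≡ false × IsHeap (suc f) s) (sym swap)
      (trans (onTop-far k k' push (remove k' t) apart) reduced ,
       place-IsHeap f below′ (trans (onTop-far k' k pop t (Far-sym k k' apart)) off))
    where
    reduced = proj₁ (below k' top')
    below′ = proj₂ (below k' top')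
    swap : remove k' (place k t) ≡ place k (remove k' t)
    swap = sym (update-far k k' push pop t apart)

heap-place : ∀ {n} {k : Fin n} {t} → Heap t → onTop k t ≡ false → Heap (place k t)
heap-place {k = k} {t} h off =
  subst (λ f → IsHeap f (place k t)) (sym pieces-place) (place-IsHeap _ h off)
  where
  pieces-place : pieces (place k t) ≡ suc (pieces t)
  pieces-place = trans (pieces-remove k (place k t) (onTop-place k t))
                       (cong (suc ∘ pieces) (remove-place k t))

heap-toggle : ∀ {n} (k : Fin n) {t} → Heap t → Heap (toggle k t)
heap-toggle k {t} h with onTop k t in e
... | true  = subst Heap (sym (toggle-onTop k t e)) (proj₂ (heap-remove k h e))
... | false = subst Heap (sym (toggle-offTop k t e)) (heap-place h e)

toggle-invol : ∀ {n} (k : Fin n) {t} → Heap t → toggle k (toggle k t) ≡ t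
toggle-invol k {t} h with onTop k t in e
... | true = begin
  toggle k (toggle k t)   ≡⟨ cong (toggle k) (toggle-onTop k t e) ⟩
  toggle k (remove k t)   ≡⟨ toggle-offTop k (remove k t) (proj₁ (heap-remove k h e)) ⟩
  place k (remove k t)    ≡⟨ place-remove k t e ⟩
  t                       ∎
  where open ≡-Reasoning
... | false = begin
  toggle k (toggle k t)   ≡⟨ cong (toggle k) (toggle-offTop k t e) ⟩
  toggle k (place k t)    ≡⟨ toggle-onTop k (place k t) (onTop-place k t) ⟩
  remove k (place k t)    ≡⟨ remove-place k t ⟩
  t                       ∎
  where open ≡-Reasoning

toggle-comm : ∀ {n} (i j : Fin n) → Far i j → ∀ {t} → Heap t →
              toggle j (toggle i (toggle j (toggle i t))) ≡ t
toggle-comm i j far {t} h = begin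
  toggle j (toggle i (toggle j (toggle i t)))  ≡⟨ cong (toggle j) (update-far i j switch switch _ far) ⟩
  toggle j (toggle j (toggle i (toggle i t)))  ≡⟨ cong (toggle j ∘ toggle j) (toggle-invol i h) ⟩
  toggle j (toggle j t)                        ≡⟨ toggle-invol j h ⟩
  t                                            ∎
  where open ≡-Reasoning

-- Depends on the heap proof, which chooses the top piece to be peeled off first.
word : ∀ {n} f {t : Stacks n} → IsHeap f t → Word n
word zero    _                    = []
word (suc f) ((k , top) , below) = k ∷ word f (proj₂ (below k top))

module Universal (n : ℕ) where

  HeapFlag : Set
  HeapFlag = Σ (Stacks n) λ t → True (isHeap? (pieces t) t)

  heapFlag-≡ : ∀ {t t'} (h : True (isHeap? (pieces t) t)) (h' : True (isHeap? (pieces t') t')) →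
               t ≡ t' → _≡_ {A = HeapFlag} (t , h) (t' , h')
  heapFlag-≡ h h' refl = cong (_ ,_) (T-irrelevant h h')

  𝒰G : PreGraph n
  Flag 𝒰G = HeapFlag
  adj  𝒰G k (t , h) = toggle k t , fromWitness (heap-toggle k (toWitness h))

  𝒰 : Premaniplex n
  graph 𝒰 = 𝒰G
  invol 𝒰 k (t , h)        = heapFlag-≡ _ h (toggle-invol k (toWitness h))
  comm  𝒰 i j far (t , h)  = heapFlag-≡ _ h (toggle-comm i j far (toWitness h))

  base : HeapFlag
  base = empty , fromWitness (subst (λ f → IsHeap f (empty {n})) (sym (pieces-empty (suc n))) refl)

  act-word : ∀ f {t} (h : IsHeap f t) → proj₁ (act 𝒰G (word f h) base) ≡ t
  act-word zero    h                     = sym h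
  act-word (suc f) {t} ((k , top) , below) = begin
    toggle k (proj₁ (act 𝒰G (word f h') base)) ≡⟨ cong (toggle k) (act-word f h') ⟩
    toggle k (remove k t)                     ≡⟨ toggle-offTop k (remove k t) (proj₁ (below k top)) ⟩
    place k (remove k t)                      ≡⟨ place-remove k t top ⟩
    t                                         ∎
    where
    open ≡-Reasoning
    h' = proj₂ (below k top)

  𝒰-connected : Connected 𝒰G
  𝒰-connected = connected-from 𝒰 base λ (t , h) →
    word (pieces t) (toWitness h) , heapFlag-≡ _ h (act-word (pieces t) (toWitness h))

  module Projection (W : Premaniplex n) (w₀ : Flag (graph W)) where
    private
      WG = graph W

    run : ∀ f {t} → IsHeap f t → Flag WG
    run f h = act WG (word f h) w₀

    -- Independence of the chosen top pieces: two distinct top pieces are far apart and commute.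
    mutual
      run-irrelevant : ∀ {f f' t t'} → f ≡ f' → t ≡ t' → (h : IsHeap f t) (h' : IsHeap f' t') →
                       run f h ≡ run f' h'
      run-irrelevant {zero}  refl refl _ _ = refl
      run-irrelevant {suc f} refl refl ((k₁ , top₁) , below₁) ((k₂ , top₂) , below₂) with k₁ ≟ᶠ k₂
      ... | yes refl =
        cong (adj WG k₁) (run-irrelevant refl refl (proj₂ (below₁ k₁ top₁)) (proj₂ (below₂ k₁ top₂)))
      ... | no k₁≢k₂ = far-tops-commute f (onTop-apart k₁ k₂ _ top₁ top₂ k₁≢k₂)
                         (proj₂ (below₁ k₁ top₁)) (proj₂ (below₂ k₂ top₂)) top₁ top₂

      far-tops-commute : ∀ f {k₁ k₂ t} → Far k₁ k₂ →
                         (h₁ : IsHeap f (remove k₁ t)) (h₂ : IsHeap f (remove k₂ t)) →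
                         onTop k₁ t ≡ true → onTop k₂ t ≡ true →
                         adj WG k₁ (run f h₁) ≡ adj WG k₂ (run f h₂)
      far-tops-commute zero {k₁} {k₂} {t} apart h₁ _ _ top₂ =
        ⊥-elim (IsHeap-zero-noTop k₂ h₁ (trans (onTop-far k₁ k₂ pop t apart) top₂))
      far-tops-commute (suc f) {k₁} {k₂} {t} apart h₁ h₂ top₁ top₂ = begin
        adj WG k₁ (run (suc f) h₁)        ≡⟨ cong (adj WG k₁) (run-irrelevant refl refl h₁ h₁′) ⟩
        adj WG k₁ (adj WG k₂ (run f r₁))  ≡⟨ adj-comm W apart _ ⟩
        adj WG k₂ (adj WG k₁ (run f r₁))  ≡⟨ cong (adj WG k₂ ∘ adj WG k₁) (run-irrelevant refl swap r₁ r₂) ⟩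
        adj WG k₂ (adj WG k₁ (run f r₂))  ≡⟨ cong (adj WG k₂) (run-irrelevant refl refl h₂′ h₂) ⟩
        adj WG k₂ (run (suc f) h₂)        ∎
        where
        open ≡-Reasoning
        top₂₁ : onTop k₂ (remove k₁ t) ≡ true
        top₂₁ = trans (onTop-far k₁ k₂ pop t apart) top₂
        top₁₂ : onTop k₁ (remove k₂ t) ≡ true
        top₁₂ = trans (onTop-far k₂ k₁ pop t (Far-sym k₁ k₂ apart)) top₁
        h₁′ : IsHeap (suc f) (remove k₁ t)
        h₁′ = (k₂ , top₂₁) , proj₂ h₁
        h₂′ : IsHeap (suc f) (remove k₂ t)
        h₂′ = (k₁ , top₁₂) , proj₂ h₂
        r₁ = proj₂ (proj₂ h₁ k₂ top₂₁)
        r₂ = proj₂ (proj₂ h₂ k₁ top₁₂)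
        swap : remove k₂ (remove k₁ t) ≡ remove k₁ (remove k₂ t)
        swap = update-far k₂ k₁ pop pop t (Far-sym k₁ k₂ apart)

    run-onTop : ∀ {k t s} (h : Heap t) → onTop k t ≡ true → remove k t ≡ s → (h' : Heap s) →
                run _ h ≡ adj WG k (run _ h')
    run-onTop {k} {t} h top refl h' = begin
      run (pieces t) h                         ≡⟨ run-irrelevant (pieces-remove k t top) refl h peeled ⟩
      adj WG k (run _ (proj₂ (below k top)))   ≡⟨ cong (adj WG k) (run-irrelevant refl refl _ h') ⟩
      adj WG k (run _ h')                      ∎
      where
      open ≡-Reasoning
      below = proj₂ (subst (λ f → IsHeap f t) (pieces-remove k t top) h)
      peeled : IsHeap (suc (pieces (remove k t))) t
      peeled = (k , top) , below

    project : HeapFlag → Flag WG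
    project (t , h) = run (pieces t) (toWitness h)

    project-base : project base ≡ w₀
    project-base = run-irrelevant (pieces-empty (suc n)) refl _ refl

    project-adj : ∀ k z → project (adj 𝒰G k z) ≡ adj WG k (project z)
    project-adj k (t , h) = by-cases (onTop k t) refl
      where
      open ≡-Reasoning
      h′ = toWitness (proj₂ (adj 𝒰G k (t , h)))
      by-cases : ∀ b → onTop k t ≡ b → project (adj 𝒰G k (t , h)) ≡ adj WG k (project (t , h))
      by-cases true e = sym (begin
        adj WG k (run _ (toWitness h))
          ≡⟨ cong (adj WG k) (run-onTop _ e (sym (toggle-onTop k t e)) h′) ⟩
        adj WG k (adj WG k (run _ h′))
          ≡⟨ invol W k _ ⟩
        run _ h′
          ∎)
      by-cases false e = run-onTop _ placed removed (toWitness h)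
        where
        placed : onTop k (toggle k t) ≡ true
        placed = trans (cong (onTop k) (toggle-offTop k t e)) (onTop-place k t)
        removed : remove k (toggle k t) ≡ t
        removed = trans (cong (remove k) (toggle-offTop k t e)) (remove-place k t)

    project-act : ∀ w z → project (act 𝒰G w z) ≡ act WG w (project z)
    project-act []      z = refl
    project-act (i ∷ w) z = trans (project-adj i (act 𝒰G w z)) (cong (adj WG i) (project-act w z))

  universal : ∀ (W : Premaniplex n) w₀ ω ω' → act 𝒰G ω base ≡ act 𝒰G ω' base →
              act (graph W) ω w₀ ≡ act (graph W) ω' w₀
  universal W w₀ ω ω' e = begin
    act (graph W) ω w₀               ≡⟨ cong (act (graph W) ω) project-base ⟨
    act (graph W) ω (project base)   ≡⟨ project-act ω base ⟨
    project (act 𝒰G ω base)          ≡⟨ cong project e ⟩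
    project (act 𝒰G ω' base)         ≡⟨ project-act ω' base ⟩
    act (graph W) ω' (project base)  ≡⟨ cong (act (graph W) ω') project-base ⟩
    act (graph W) ω' w₀              ∎
    where
    open ≡-Reasoning
    open Projection W w₀

module _ {n m : ℕ} (V : VoltageOperator n m) where
  open Universal n

  generator-as-voltage : PreservesConnectivity V → ∀ y₀ (j : Fin n) → Σ (Word m) λ w →
                         ∀ (W : Premaniplex n) w₀ → act (graph W) (η V y₀ w) w₀ ≡ adj (graph W) j w₀
  generator-as-voltage preserves y₀ j with preserves 𝒰 𝒰-connected (base , y₀) (adj 𝒰G j base , y₀)
  ... | w , reaches = w , λ W w₀ → universal W w₀ (η V y₀ w) [ j ] realised
    where
    realised : act 𝒰G (η V y₀ w) base ≡ adj 𝒰G j base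
    realised = trans (sym (cong proj₁ (act-⋊ 𝒰 V w base y₀))) (cong proj₁ reaches)

module _ {n m : ℕ} (X : Premaniplex n) (V : VoltageOperator n m) (γ : Aut (X ⋊ V)) where
  private
    XG = graph X
    YG = graph (Y V)

  preserves-Y : Connected (X ⋊ V) → ∀ {x₀ y₀} → proj₂ (fwd γ (x₀ , y₀)) ≡ y₀ →
                ∀ x y → proj₂ (fwd γ (x , y)) ≡ y
  preserves-Y conn {x₀} {y₀} fixes x y with conn (x₀ , y₀) (x , y)
  ... | w , refl = begin
    proj₂ (fwd γ (act (X ⋊ V) w (x₀ , y₀)))   ≡⟨ cong proj₂ (fwd-act γ w (x₀ , y₀)) ⟩
    proj₂ (act (X ⋊ V) w (fwd γ (x₀ , y₀)))   ≡⟨ act-⋊-Y X V w _ ⟩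
    act YG w (proj₂ (fwd γ (x₀ , y₀)))        ≡⟨ cong (act YG w) fixes ⟩
    act YG w y₀                               ≡⟨ act-⋊-Y X V w _ ⟨
    proj₂ (act (X ⋊ V) w (x₀ , y₀))           ∎
    where open ≡-Reasoning

  FibrewiseBy : (Flag XG → Flag XG) → Flag YG → Set
  FibrewiseBy f y = ∀ x → fwd γ (x , y) ≡ (f x , y)

  fibrewise-along-dart : ∀ {f y i} → η V y [ i ] ≈C [] → FibrewiseBy f y → FibrewiseBy f (adj YG i y)
  fibrewise-along-dart {f} {y} {i} trivial fibrewise x = begin
    fwd γ (x , adj YG i y)                 ≡⟨ cong (λ x' → fwd γ (x' , adj YG i y)) (fixes x) ⟨
    fwd γ (adj (X ⋊ V) i (x , y))          ≡⟨ hom γ i (x , y) ⟩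
    adj (X ⋊ V) i (fwd γ (x , y))          ≡⟨ cong (adj (X ⋊ V) i) (fibrewise x) ⟩
    adj (X ⋊ V) i (f x , y)                ≡⟨ cong (_, adj YG i y) (fixes (f x)) ⟩
    (f x , adj YG i y)                     ∎
    where
    open ≡-Reasoning
    fixes : ∀ x → act XG (η V y [ i ]) x ≡ x
    fixes = act-resp-≈C X trivial

  fibrewise-along-forest : ∀ {T f} → (∀ y i → T y i → η V y [ i ] ≈C []) →
                           ∀ {y} w → AllIn YG T y w → FibrewiseBy f y → FibrewiseBy f (endpoint YG y w)
  fibrewise-along-forest trivial []      _              fibrewise = fibrewise
  fibrewise-along-forest trivial (i ∷ w) (in-T , rest) fibrewise =
    fibrewise-along-forest trivial w rest (fibrewise-along-dart (trivial _ i in-T) fibrewise)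

  fibrewise-from-forest : ∀ {T f y₀} → SpanningForest YG T → (∀ y i → T y i → η V y [ i ] ≈C []) →
                          Connected YG → FibrewiseBy f y₀ → ∀ y → FibrewiseBy f y
  fibrewise-from-forest {y₀ = y₀} forest trivial Y-connected fibrewise y
    with forest-path forest Y-connected y₀ y
  ... | w , in-T , refl = fibrewise-along-forest trivial w in-T fibrewise

  fibre-map-commutes-with-voltages : ∀ {f} → (∀ y → FibrewiseBy f y) →
                                     ∀ y w x → f (act XG (η V y w) x) ≡ act XG (η V y w) (f x)
  fibre-map-commutes-with-voltages {f} fibrewise y w x = cong proj₁ (begin
    (f (act XG (η V y w) x) , act YG w y)        ≡⟨ fibrewise (act YG w y) _ ⟨
    fwd γ (act XG (η V y w) x , act YG w y)      ≡⟨ cong (fwd γ) (act-⋊ X V w x y) ⟨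
    fwd γ (act (X ⋊ V) w (x , y))                ≡⟨ fwd-act γ w (x , y) ⟩
    act (X ⋊ V) w (fwd γ (x , y))                ≡⟨ cong (act (X ⋊ V) w) (fibrewise y x) ⟩
    act (X ⋊ V) w (f x , y)                      ≡⟨ act-⋊ X V w (f x) y ⟩
    (act XG (η V y w) (f x) , act YG w y)        ∎)
    where open ≡-Reasoning

  fibre-map-hom : PreservesConnectivity V → ∀ {f} y₀ → (∀ y → FibrewiseBy f y) →
                  ∀ j x → f (adj XG j x) ≡ adj XG j (f x)
  fibre-map-hom preserves {f} y₀ fibrewise j x with generator-as-voltage V preserves y₀ j
  ... | w , realises = begin
    f (adj XG j x)              ≡⟨ cong f (realises X x) ⟨
    f (act XG (η V y₀ w) x)     ≡⟨ fibre-map-commutes-with-voltages fibrewise y₀ w x ⟩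
    act XG (η V y₀ w) (f x)     ≡⟨ realises X (f x) ⟩
    adj XG j (f x)              ∎
    where open ≡-Reasoning

  fibre-automorphism : PreservesConnectivity V → ∀ {f} y₀ → (∀ y → FibrewiseBy f y) → Aut XG
  fwd (fibre-automorphism _ {f} _ _)                = f
  bwd (fibre-automorphism _ y₀ _) x                 = proj₁ (bwd γ (x , y₀))
  bwd∘fwd (fibre-automorphism _ y₀ fibrewise) x     =
    cong proj₁ (trans (cong (bwd γ) (sym (fibrewise y₀ x))) (bwd∘fwd γ (x , y₀)))
  fwd∘bwd (fibre-automorphism _ y₀ fibrewise) x     =
    cong proj₁ (trans (sym (fibrewise _ _)) (fwd∘bwd γ (x , y₀)))
  hom (fibre-automorphism preserves y₀ fibrewise)   = fibre-map-hom preserves y₀ fibrewise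

proposition4p2 : {n m : ℕ} (X : Premaniplex n) (V : VoltageOperator n m) →
    HasTrivialSpanningForest V →
    Connected (graph X) →
    PreservesConnectivity V →
    (γ : Aut (X ⋊ V)) →
    Σ (Flag (graph X)) (λ x₀ → Σ (Flag (graph (Y V))) λ y₀ → Σ (Flag (graph X)) λ x₁ →
      fwd γ (x₀ , y₀) ≡ (x₁ , y₀)) →
    Σ (Aut (graph X)) λ σ →
      ∀ (x : Flag (graph X)) (y : Flag (graph (Y V))) → fwd γ (x , y) ≡ (fwd σ x , y)
proposition4p2 X V (_ , forest , trivial) X-connected preserves γ (x₀ , y₀ , _ , γx₀) =
  fibre-automorphism X V γ preserves y₀ fibrewise , λ x y → fibrewise y x
  where
  ⋊-connected = preserves X X-connected
  f = λ x → proj₁ (fwd γ (x , y₀))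
  fibrewise : ∀ y → FibrewiseBy X V γ f y
  fibrewise = fibrewise-from-forest X V γ forest trivial
                (⋊-connected⇒Y-connected X V ⋊-connected x₀)
                (λ x → cong (f x ,_) (preserves-Y X V γ ⋊-connected (cong proj₂ γx₀) x y₀))
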